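{- Let \(G\) be a finite simple connected graph with \(\Delta(G)\leq 4\), not isomorphic to \(O_3\). Then \(K(G)\) has no induced subgraph isomorphic to \(O_{3}\).
   Context: A clique is a maximal complete subgraph; \(K(G)\) is the intersection graph of the cliques of \(G\). \(O_3\) is the octahedral graph, the complement of the disjoint union of three edges. -}

module Defs where

open import Data.Nat using (ℕ; _≤_; _/_)
open import Data.Fin using (Fin; toℕ)
open import Data.Fin.Properties using () renaming (_≟_ to _≟ᶠ_)
open import Data.Nat.Properties using () renaming (_≟_ to _≟ⁿ_)
open import Relation.Nullary.Decidable using (¬?)
open import Relation.Nullary.Decidable using (_×-dec_)
open import Data.Product using (_,_; proj₁)
open import Data.Fin.Subset using (Subset; _∈_; _⊆_; _∩_; Nonempty; ∣_∣)
open import Data.Vec using (tabulate)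
open import Data.Product using (Σ; _×_; ∃)
open import Relation.Nullary using (¬_; Dec; does)
open import Relation.Binary.PropositionalEquality using (_≡_; _≢_; refl) renaming (sym to ≡-sym)
open import Function.Bundles using (_⇔_; _↔_; Inverse)
open import Level using (0ℓ)

record Graph : Set₁ where
  field
    n     : ℕ
    Adj   : Fin n → Fin n → Set
    adj?  : ∀ u v → Dec (Adj u v)
    sym   : ∀ {u v} → Adj u v → Adj v u
    irrefl : ∀ {v} → ¬ Adj v v

open Graph public

N : (G : Graph) → Fin (n G) → Subset (n G)
N G v = tabulate (λ u → does (adj? G v u))

deg : (G : Graph) → Fin (n G) → ℕ
deg G v = ∣ N G v ∣

MaxDeg≤ : Graph → ℕ → Set
MaxDeg≤ G d = ∀ v → deg G v ≤ d

-- walks and connectivity (connected graphs are nonempty)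
data Walk (G : Graph) : Fin (n G) → Fin (n G) → Set where
  here : ∀ {v} → Walk G v v
  step : ∀ {u v w} → Adj G u v → Walk G v w → Walk G u w

Connected : Graph → Set
Connected G = Fin (n G) × (∀ u v → Walk G u v)

_≅_ : Graph → Graph → Set
G ≅ H = Σ (Fin (n G) ↔ Fin (n H)) λ φ →
  ∀ u v → Adj G u v ⇔ Adj H (Inverse.to φ u) (Inverse.to φ v)

Complete : (G : Graph) → Subset (n G) → Set
Complete G S = ∀ u v → u ∈ S → v ∈ S → u ≢ v → Adj G u v

IsClique : (G : Graph) → Subset (n G) → Set
IsClique G S = Complete G S × (∀ T → Complete G T → S ⊆ T → T ≡ S)

KAdj : (G : Graph) → Subset (n G) → Subset (n G) → Set
KAdj G Q R = Q ≢ R × Nonempty (Q ∩ R)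

-- the octahedral graph O₃ on Fin 6: complement of the perfect matching
-- {0,1},{2,3},{4,5}
O3Adj : Fin 6 → Fin 6 → Set
O3Adj i j = i ≢ j × (toℕ i / 2 ≢ toℕ j / 2)

KHasInducedO3 : Graph → Set
KHasInducedO3 G = Σ (Fin 6 → Subset (n G)) λ f →
  (∀ i → IsClique G (f i)) ×
  (∀ i j → f i ≡ f j → i ≡ j) ×
  (∀ i j → O3Adj i j ⇔ KAdj G (f i) (f j))

O₃ : Graph
O₃ = record
  { n = 6
  ; Adj = O3Adj
  ; adj? = λ i j → ¬? (i ≟ᶠ j) ×-dec ¬? ((toℕ i / 2) ≟ⁿ (toℕ j / 2))
  ; sym = λ { (p , q) → (λ e → p (≡-sym e)) , (λ e → q (≡-sym e)) }
  ; irrefl = λ p → proj₁ p refl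
  }

-- An induced O₃ in K(G) consists of three pairs of antipodal cliques (A, A'),
-- (B, B'), (C, C'): antipodal cliques are disjoint, any two others meet.  If
-- some vertex x lies in A ∩ B ∩ C, its six neighbours in the intersections of
-- two cliques form a hexagon in which only consecutive vertices may coincide;
-- as x has degree at most 4 at least two pairs coincide, producing more
-- vertices lying in three of the cliques.  Clique maximality and the degree
-- bound then force six vertices inducing O₃ in G, each with all its four
-- neighbours among them, so by connectivity G itself is O₃.  Such an x exists
-- up to exchanging cliques within their pairs, for otherwise a vertex of A ∩ B
-- would have five distinct neighbours.
module Submission where

open import Defs
open import Data.Bool using (Bool; false; true; not; _xor_; if_then_else_)
open import Data.Empty using (⊥; ⊥-elim)
open import Data.Fin using (Fin; toℕ)
open import Data.Fin.Patterns using (0F; 1F; 2F; 3F; 4F; 5F)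
open import Data.Fin.Permutation using (Permutation′; _⟨$⟩ʳ_; transpose) renaming (id to idₚ)
open import Data.Fin.Properties using (_≟_; ¬∀⟶∃¬; toℕ-injective)
open import Data.Fin.Subset using (Subset; _∈_; _∉_; _∪_; ⁅_⁆; ∣_∣)
open import Data.Fin.Subset.Properties
  using (_∈?_; x∈p∩q⁺; x∈p∩q⁻; x∈p∪q⁺; x∈p∪q⁻; p⊆p∪q; x∈⁅x⁆; x∈⁅y⁆⇒x≡y; x∈p∧x≢y⇒x∈p-y; x∈p⇒∣p-x∣<∣p∣)
open import Data.List using (List; []; _∷_; length)
open import Data.List.Membership.Propositional using () renaming (_∈_ to _∈ₗ_)
open import Data.List.Relation.Unary.All as All using (All; []; _∷_)
open import Data.List.Relation.Unary.All.Properties using (¬Any⇒All¬)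
open import Data.List.Relation.Unary.AllPairs using ([]; _∷_)
open import Data.List.Relation.Unary.Any using (here; there)
open import Data.List.Relation.Unary.Unique.Propositional using (Unique)
open import Data.Nat using (_/_; _≤_; z≤n; s≤s)
open import Data.Nat.Properties using (≤-trans; n≮n)
open import Data.Product using (∃; ∃₂; _×_; _,_; proj₁)
open import Data.Sum using (_⊎_; inj₁; inj₂)
open import Data.Vec using (Vec; []; _∷_; lookup)
open import Data.Vec.Properties using (lookup∘tabulate; lookup⇒[]=)
open import Function using (_∘_)
open import Function.Bundles using (_⇔_; Equivalence; Injection; mk⇔; mk↔ₛ′)
open import Function.Properties.Equivalence using () renaming (sym to ⇔-sym; trans to ⇔-trans)
open import Function.Properties.Inverse using (↔⇒↣)
open import Relation.Binary.PropositionalEquality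
  using (_≡_; _≢_; refl; trans; cong; subst; ≢-sym) renaming (sym to ≡-sym)
open import Relation.Nullary using (¬_; yes; no)
open import Relation.Nullary.Decidable using (False; dec-true; decidable-stable; toWitnessFalse; _→-dec_)

length≤∣p∣ : ∀ {m} {p : Subset m} {xs : List (Fin m)} → Unique xs → All (_∈ p) xs
  → length xs ≤ ∣ p ∣
length≤∣p∣ [] [] = z≤n
length≤∣p∣ (x≢xs ∷ unique) (x∈p ∷ xs⊆p) =
  ≤-trans (s≤s (length≤∣p∣ unique xs⊆p-x)) (x∈p⇒∣p-x∣<∣p∣ x∈p)
  where
  xs⊆p-x = All.zipWith (λ (x≢y , y∈p) → x∈p∧x≢y⇒x∈p-y y∈p (≢-sym x≢y)) (x≢xs , xs⊆p)

∉∈⇒≢ : ∀ {m} {p : Subset m} {x y} → x ∉ p → y ∈ p → x ≢ y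
∉∈⇒≢ x∉p y∈p refl = x∉p y∈p

pattern 1st = here refl
pattern 2nd = there (here refl)
pattern 3rd = there (there (here refl))
pattern 4th = there (there (there (here refl)))

-- O₃ in coordinates: its vertex 2a + s is the pole of sign s on axis a, and the
-- non-adjacent pairs are exactly the antipodes, which share an axis.
index : Fin 3 → Bool → Fin 6
index 0F false = 0F
index 0F true  = 1F
index 1F false = 2F
index 1F true  = 3F
index 2F false = 4F
index 2F true  = 5F

axis : Fin 6 → Fin 3
axis 0F = 0F
axis 1F = 0F
axis 2F = 1F
axis 3F = 1F
axis 4F = 2F
axis 5F = 2F

sign : Fin 6 → Bool
sign 0F = false
sign 1F = true
sign 2F = false
sign 3F = true
sign 4F = false
sign 5F = true

index-axis-sign : ∀ i → index (axis i) (sign i) ≡ i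
index-axis-sign 0F = refl
index-axis-sign 1F = refl
index-axis-sign 2F = refl
index-axis-sign 3F = refl
index-axis-sign 4F = refl
index-axis-sign 5F = refl

toℕ-index/2 : ∀ a s → toℕ (index a s) / 2 ≡ toℕ a
toℕ-index/2 0F false = refl
toℕ-index/2 0F true  = refl
toℕ-index/2 1F false = refl
toℕ-index/2 1F true  = refl
toℕ-index/2 2F false = refl
toℕ-index/2 2F true  = refl

index-antipodes-distinct : ∀ a → index a false ≢ index a true
index-antipodes-distinct 0F ()
index-antipodes-distinct 1F ()
index-antipodes-distinct 2F ()

O3Adj-index⇔ : ∀ a s b t → O3Adj (index a s) (index b t) ⇔ a ≢ b
O3Adj-index⇔ a s b t = mk⇔ (λ (_ , axes≢) a≡b → axes≢ (same-axis a≡b)) axes-differ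
  where
  same-axis : a ≡ b → toℕ (index a s) / 2 ≡ toℕ (index b t) / 2
  same-axis refl = trans (toℕ-index/2 a s) (≡-sym (toℕ-index/2 a t))
  axes-differ : a ≢ b → O3Adj (index a s) (index b t)
  axes-differ a≢b = halves≢ ∘ cong (λ i → toℕ i / 2) , halves≢
    where
    halves≢ : toℕ (index a s) / 2 ≢ toℕ (index b t) / 2
    halves≢ e = a≢b (toℕ-injective (trans (≡-sym (toℕ-index/2 a s)) (trans e (toℕ-index/2 b t))))

module _ (G : Graph) where

  private
    V : Set
    V = Fin (n G)

    infix 4 _~_ _≁_
    _~_ _≁_ : V → V → Set
    u ~ v = Adj G u v
    u ≁ v = ¬ u ~ v

    ~-sym : ∀ {u v} → u ~ v → v ~ u
    ~-sym = Graph.sym G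

  open import Data.List.Membership.DecPropositional (_≟_ {n G}) using () renaming (_∈?_ to _∈ₗ?_)

  ~⇒≢ : ∀ {u v} → u ~ v → u ≢ v
  ~⇒≢ u~v refl = irrefl G u~v

  ~-≁⇒≢ : ∀ {u v w} → u ~ w → v ≁ w → u ≢ v
  ~-≁⇒≢ u~w v≁w refl = v≁w u~w

  ~⇒∈N : ∀ {v u} → v ~ u → u ∈ N G v
  ~⇒∈N {v} {u} v~u = lookup⇒[]= u _ (trans (lookup∘tabulate _ u) (dec-true (adj? G v u) v~u))

  distinct-neighbours≤deg : ∀ {v us} → Unique us → All (v ~_) us → length us ≤ deg G v
  distinct-neighbours≤deg unique adjacent = length≤∣p∣ unique (All.map ~⇒∈N adjacent)

  neighbour∈saturated : ∀ {d v u us} → MaxDeg≤ G d → Unique us → All (v ~_) us → length us ≡ d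
    → v ~ u → u ∈ₗ us
  neighbour∈saturated {v = v} {u} {us} Δ unique adjacent refl v~u with u ∈ₗ? us
  ... | yes u∈us = u∈us
  ... | no u∉us = ⊥-elim (n≮n (length us)
         (≤-trans (distinct-neighbours≤deg (¬Any⇒All¬ us u∉us ∷ unique) (v~u ∷ adjacent)) (Δ v)))

  connected-closure : Connected G → (P : V → Set) → (∀ {u v} → u ~ v → P u → P v)
    → ∀ {v₀} → P v₀ → ∀ v → P v
  connected-closure (_ , walk) P closed {v₀} Pv₀ v = along (walk v₀ v) Pv₀
    where
    along : ∀ {u w} → Walk G u w → P u → P w
    along here Pu = Pu
    along (step u~v walk) Pu = along walk (closed u~v Pu)

  Complete-∪⁅⁆ : ∀ {Q v} → Complete G Q → (∀ u → u ∈ Q → u ~ v) → Complete G (Q ∪ ⁅ v ⁆)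
  Complete-∪⁅⁆ {Q} {v} complete ~v u w u∈ w∈ u≢w with x∈p∪q⁻ Q ⁅ v ⁆ u∈ | x∈p∪q⁻ Q ⁅ v ⁆ w∈
  ... | inj₁ u∈Q | inj₁ w∈Q = complete u w u∈Q w∈Q u≢w
  ... | inj₁ u∈Q | inj₂ w∈v rewrite x∈⁅y⁆⇒x≡y v w∈v = ~v u u∈Q
  ... | inj₂ u∈v | inj₁ w∈Q rewrite x∈⁅y⁆⇒x≡y v u∈v = ~-sym (~v w w∈Q)
  ... | inj₂ u∈v | inj₂ w∈v = ⊥-elim (u≢w (trans (x∈⁅y⁆⇒x≡y v u∈v) (≡-sym (x∈⁅y⁆⇒x≡y v w∈v))))

  clique-nonneighbour : ∀ {Q v} → IsClique G Q → v ∉ Q → ∃ λ u → u ∈ Q × u ≁ v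
  clique-nonneighbour {Q} {v} (complete , maximal) v∉Q
    with ¬∀⟶∃¬ (n G) (λ u → u ∈ Q → u ~ v) (λ u → (u ∈? Q) →-dec (adj? G u v)) all-adjacent-absurd
    where
    all-adjacent-absurd : ¬ (∀ u → u ∈ Q → u ~ v)
    all-adjacent-absurd ~v = v∉Q (subst (v ∈_) (maximal _ (Complete-∪⁅⁆ complete ~v) (p⊆p∪q ⁅ v ⁆))
                                               (x∈p∪q⁺ (inj₂ (x∈⁅x⁆ v))))
  ... | u , ¬[u∈Q→u~v] =
    u , decidable-stable (u ∈? Q) (λ u∉Q → ¬[u∈Q→u~v] (⊥-elim ∘ u∉Q)) , λ u~v → ¬[u∈Q→u~v] (λ _ → u~v)

  record Octahedron : Set where
    field
      pole : Fin 3 → Bool → V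
      edges₀₁ : ∀ s t → pole 0F s ~ pole 1F t
      edges₀₂ : ∀ s t → pole 0F s ~ pole 2F t
      edges₁₂ : ∀ s t → pole 1F s ~ pole 2F t
      antipodes-nonadjacent : ∀ a → pole a false ≁ pole a true
      antipodes-distinct : ∀ a → pole a false ≢ pole a true

    edge : ∀ {a b} → a ≢ b → ∀ s t → pole a s ~ pole b t
    edge {0F} {0F} a≢b = ⊥-elim (a≢b refl)
    edge {0F} {1F} _ = edges₀₁
    edge {0F} {2F} _ = edges₀₂
    edge {1F} {0F} _ s t = ~-sym (edges₀₁ t s)
    edge {1F} {1F} a≢b = ⊥-elim (a≢b refl)
    edge {1F} {2F} _ = edges₁₂
    edge {2F} {0F} _ s t = ~-sym (edges₀₂ t s)
    edge {2F} {1F} _ s t = ~-sym (edges₁₂ t s)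
    edge {2F} {2F} a≢b = ⊥-elim (a≢b refl)

    poles-distinct : ∀ {a b} → a ≢ b → ∀ s t → pole a s ≢ pole b t
    poles-distinct a≢b s t = ~⇒≢ (edge a≢b s t)

    same-axis-nonadjacent : ∀ a s t → pole a s ≁ pole a t
    same-axis-nonadjacent a false false = irrefl G
    same-axis-nonadjacent a false true  = antipodes-nonadjacent a
    same-axis-nonadjacent a true  false = antipodes-nonadjacent a ∘ ~-sym
    same-axis-nonadjacent a true  true  = irrefl G

    pole-adjacent⇔ : ∀ a s b t → pole a s ~ pole b t ⇔ a ≢ b
    pole-adjacent⇔ a s b t = mk⇔ (λ { adj refl → same-axis-nonadjacent a s t adj }) (λ a≢b → edge a≢b s t)

    pole-injective : ∀ {a s b t} → pole a s ≡ pole b t → a ≡ b × s ≡ t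
    pole-injective {a} {s} {b} {t} e with a ≟ b
    ... | no a≢b = ⊥-elim (poles-distinct a≢b s t e)
    ... | yes refl = refl , same-sign s t e
      where
      same-sign : ∀ s t → pole a s ≡ pole a t → s ≡ t
      same-sign false false _ = refl
      same-sign false true  e = ⊥-elim (antipodes-distinct a e)
      same-sign true  false e = ⊥-elim (antipodes-distinct a (≡-sym e))
      same-sign true  true  _ = refl

  module _ (Δ : MaxDeg≤ G 4) where

    among-four-neighbours : ∀ {v a b c d u} → v ~ a → v ~ b → v ~ c → v ~ d
      → a ≢ b → a ≢ c → a ≢ d → b ≢ c → b ≢ d → c ≢ d → v ~ u → u ∈ₗ a ∷ b ∷ c ∷ d ∷ []
    among-four-neighbours va vb vc vd ab ac ad bc bd cd =
      neighbour∈saturated Δ ((ab ∷ ac ∷ ad ∷ []) ∷ (bc ∷ bd ∷ []) ∷ (cd ∷ []) ∷ [] ∷ [])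
                            (va ∷ vb ∷ vc ∷ vd ∷ []) refl

    no-five-distinct-neighbours : ∀ {v a b c d e} → v ~ a → v ~ b → v ~ c → v ~ d → v ~ e
      → a ≢ b → a ≢ c → a ≢ d → a ≢ e → b ≢ c → b ≢ d → b ≢ e → c ≢ d → c ≢ e → d ≢ e → ⊥
    no-five-distinct-neighbours {v} va vb vc vd ve ab ac ad ae bc bd be cd ce de =
      n≮n 4 (≤-trans (distinct-neighbours≤deg
                        ((ab ∷ ac ∷ ad ∷ ae ∷ []) ∷ (bc ∷ bd ∷ be ∷ []) ∷ (cd ∷ ce ∷ []) ∷ (de ∷ []) ∷ [] ∷ [])
                        (va ∷ vb ∷ vc ∷ vd ∷ ve ∷ []))
                     (Δ v))

    data ConsecutiveEqual (a b c d e : V) : Set where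
      ≡₁₂ : a ≡ b → ConsecutiveEqual a b c d e
      ≡₂₃ : b ≡ c → ConsecutiveEqual a b c d e
      ≡₃₄ : c ≡ d → ConsecutiveEqual a b c d e
      ≡₄₅ : d ≡ e → ConsecutiveEqual a b c d e

    consecutive-equal : ∀ {v a b c d e} → v ~ a → v ~ b → v ~ c → v ~ d → v ~ e
      → a ≢ c → a ≢ d → a ≢ e → b ≢ d → b ≢ e → c ≢ e → ConsecutiveEqual a b c d e
    consecutive-equal {a = a} {b} {c} {d} {e} va vb vc vd ve ac ad ae bd be ce
      with a ≟ b | b ≟ c | c ≟ d | d ≟ e
    ... | yes a≡b | _ | _ | _ = ≡₁₂ a≡b
    ... | no _ | yes b≡c | _ | _ = ≡₂₃ b≡c
    ... | no _ | no _ | yes c≡d | _ = ≡₃₄ c≡d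
    ... | no _ | no _ | no _ | yes d≡e = ≡₄₅ d≡e
    ... | no ab | no bc | no cd | no de =
      ⊥-elim (no-five-distinct-neighbours va vb vc vd ve ab ac ad ae bc bd be cd ce de)

    octahedron⇒≅O₃ : Connected G → Octahedron → G ≅ O₃
    octahedron⇒≅O₃ conn O = mk↔ₛ′ toO₃ vertex toO₃∘vertex vertex∘toO₃ , adjacency
      where
      open Octahedron O

      IsPole : V → Set
      IsPole u = ∃₂ λ a s → pole a s ≡ u

      neighbour-via : ∀ {a s u} b c → a ≢ b → a ≢ c → b ≢ c → pole a s ~ u → IsPole u
      neighbour-via {a} {s} b c a≢b a≢c b≢c adj
        with among-four-neighbours (edge a≢b s false) (edge a≢b s true) (edge a≢c s false) (edge a≢c s true)
               (antipodes-distinct b) (poles-distinct b≢c false false) (poles-distinct b≢c false true)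
               (poles-distinct b≢c true false) (poles-distinct b≢c true true) (antipodes-distinct c) adj
      ... | 1st = b , false , refl
      ... | 2nd = b , true , refl
      ... | 3rd = c , false , refl
      ... | 4th = c , true , refl

      neighbour-of-pole : ∀ {a s u} → pole a s ~ u → IsPole u
      neighbour-of-pole {0F} = neighbour-via 1F 2F (λ ()) (λ ()) (λ ())
      neighbour-of-pole {1F} = neighbour-via 0F 2F (λ ()) (λ ()) (λ ())
      neighbour-of-pole {2F} = neighbour-via 0F 1F (λ ()) (λ ()) (λ ())

      every-vertex-is-a-pole : ∀ u → IsPole u
      every-vertex-is-a-pole = connected-closure conn IsPole
        (λ { u~v (_ , _ , refl) → neighbour-of-pole u~v }) {pole 0F false} (0F , false , refl)

      coordinates : ∀ {u} → IsPole u → Fin 6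
      coordinates (a , s , _) = index a s

      toO₃ : V → Fin 6
      toO₃ u = coordinates (every-vertex-is-a-pole u)

      vertex : Fin 6 → V
      vertex i = pole (axis i) (sign i)

      vertex-index : ∀ a s → vertex (index a s) ≡ pole a s
      vertex-index 0F false = refl
      vertex-index 0F true  = refl
      vertex-index 1F false = refl
      vertex-index 1F true  = refl
      vertex-index 2F false = refl
      vertex-index 2F true  = refl

      vertex∘coordinates : ∀ {u} (p : IsPole u) → vertex (coordinates p) ≡ u
      vertex∘coordinates (a , s , refl) = vertex-index a s

      vertex∘toO₃ : ∀ u → vertex (toO₃ u) ≡ u
      vertex∘toO₃ u = vertex∘coordinates (every-vertex-is-a-pole u)

      coordinates-of-vertex : ∀ i (p : IsPole (vertex i)) → coordinates p ≡ i
      coordinates-of-vertex i (a , s , e) with pole-injective e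
      ... | refl , refl = index-axis-sign i

      toO₃∘vertex : ∀ i → toO₃ (vertex i) ≡ i
      toO₃∘vertex i = coordinates-of-vertex i (every-vertex-is-a-pole (vertex i))

      coordinates-adjacent⇔ : ∀ {u v} (p : IsPole u) (q : IsPole v)
        → u ~ v ⇔ O3Adj (coordinates p) (coordinates q)
      coordinates-adjacent⇔ (a , s , refl) (b , t , refl) =
        ⇔-trans (pole-adjacent⇔ a s b t) (⇔-sym (O3Adj-index⇔ a s b t))

      adjacency : ∀ u v → u ~ v ⇔ O3Adj (toO₃ u) (toO₃ v)
      adjacency u v = coordinates-adjacent⇔ (every-vertex-is-a-pole u) (every-vertex-is-a-pole v)

  -- The six cliques are indexed like the vertices of O₃.
  record CliqueOctahedron : Set where
    field
      Q : Fin 3 → Bool → Subset (n G)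
      isClique : ∀ a s → IsClique G (Q a s)
      antipodes-disjoint : ∀ a {v} → v ∈ Q a false → v ∈ Q a true → ⊥
      meet : ∀ {a b} → a ≢ b → ∀ s t → ∃ λ v → v ∈ Q a s × v ∈ Q b t

    A A' B B' C C' : Subset (n G)
    A  = Q 0F false
    A' = Q 0F true
    B  = Q 1F false
    B' = Q 1F true
    C  = Q 2F false
    C' = Q 2F true

    antipodal : ∀ a s {v} → v ∈ Q a s → v ∉ Q a (not s)
    antipodal a false = antipodes-disjoint a
    antipodal a true v∈Q v∈Q' = antipodes-disjoint a v∈Q' v∈Q

    apart : ∀ {a s u v} → u ∈ Q a s → v ∈ Q a (not s) → u ≢ v
    apart {a} {s} u∈Q v∈Q' refl = antipodal a s u∈Q v∈Q'

    adjacent : ∀ {a s u v} → u ∈ Q a s → v ∈ Q a s → u ≢ v → u ~ v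
    adjacent {a} {s} = proj₁ (isClique a s) _ _

    equal-or-adjacent : ∀ {a s u v} → u ∈ Q a s → v ∈ Q a s → v ≡ u ⊎ u ~ v
    equal-or-adjacent {u = u} {v} u∈Q v∈Q with v ≟ u
    ... | yes v≡u = inj₁ v≡u
    ... | no v≢u = inj₂ (adjacent u∈Q v∈Q (≢-sym v≢u))

    nonneighbour-in : ∀ {a s v} → v ∉ Q a s → ∃ λ u → u ∈ Q a s × u ≁ v
    nonneighbour-in {a} {s} = clique-nonneighbour (isClique a s)

    nonneighbour-in-antipode : ∀ {a s v} → v ∈ Q a s → ∃ λ u → u ∈ Q a (not s) × u ≁ v
    nonneighbour-in-antipode {a} {s} v∈Q = nonneighbour-in (antipodal a s v∈Q)

    common : ∀ a s b t {a≢b : False (a ≟ b)} → ∃ λ v → v ∈ Q a s × v ∈ Q b t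
    common a s b t {a≢b} = meet (toWitnessFalse a≢b) s t

  relabel : Permutation′ 3 → (Fin 3 → Bool) → CliqueOctahedron → CliqueOctahedron
  relabel π φ K = record
    { Q = λ a s → Q (π ⟨$⟩ʳ a) (s xor φ a)
    ; isClique = λ a s → isClique (π ⟨$⟩ʳ a) (s xor φ a)
    ; antipodes-disjoint = λ a → antipodal (π ⟨$⟩ʳ a) (φ a)
    ; meet = λ {a} {b} a≢b s t → meet (a≢b ∘ Injection.injective (↔⇒↣ π)) (s xor φ a) (t xor φ b)
    }
    where open CliqueOctahedron K

  swap : Fin 3 → Fin 3 → CliqueOctahedron → CliqueOctahedron
  swap i j = relabel (transpose i j) (λ _ → false)

  -- (A, B, C) ↦ (B, C, A) and back
  rotate rotate⁻¹ : CliqueOctahedron → CliqueOctahedron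
  rotate K = swap 1F 2F (swap 0F 1F K)
  rotate⁻¹ K = swap 0F 1F (swap 1F 2F K)

  flipAxes : Vec Bool 3 → CliqueOctahedron → CliqueOctahedron
  flipAxes φ = relabel idₚ (lookup φ)

  module _ (conn : Connected G) (Δ : MaxDeg≤ G 4) where

    -- A vertex of type XYZ is one lying in the cliques X, Y and Z.  Every lemma
    -- below starts from a vertex x of type ABC.
    module Forced (K : CliqueOctahedron) where
      open CliqueOctahedron K

      A'∩B⊆C' : ∀ {x y z u} → x ∈ A → x ∈ B → x ∈ C → y ∈ A → y ∈ B → y ∈ C' → z ∈ A → z ∈ B' → z ∈ C
        → u ∈ A' → u ∈ B → u ∈ C'
      A'∩B⊆C' {x} {y} {z} {u} xA xB xC yA yB yC' zA zB' zC uA' uB with nonneighbour-in-antipode xC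
      ... | w , wC' , w≁x = u∈C'
        where
        u~x : u ~ x
        u~x = adjacent uB xB (apart uA' xA)
        z~x : z ~ x
        z~x = adjacent zA xA (apart zB' xB)
        y~x : y ~ x
        y~x = adjacent yA xA (apart yC' xC)
        y~u : y ~ u
        y~u = adjacent yB uB (apart yA uA')
        neighbour-of-y : ∀ {v} → y ~ v → v ∈ₗ x ∷ z ∷ u ∷ w ∷ []
        neighbour-of-y = among-four-neighbours Δ y~x (adjacent yA zA (apart yC' zC)) y~u
          (adjacent yC' wC' (~-≁⇒≢ y~x w≁x))
          (apart xB zB') (apart xA uA') (apart xC wC') (apart zA uA') (~-≁⇒≢ z~x w≁x) (~-≁⇒≢ u~x w≁x)
        u∈C' : u ∈ C'
        u∈C' with common 0F true 2F true
        ... | v , vA' , vC' with neighbour-of-y (adjacent yC' vC' (apart yA vA'))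
        ... | 1st = ⊥-elim (antipodal 0F false xA vA')
        ... | 2nd = ⊥-elim (antipodal 0F false zA vA')
        ... | 3rd = vC'
        ... | 4th with u ∈? C'
        ...   | yes uC' = uC'
        ...   | no u∉C' with nonneighbour-in u∉C'
        ...     | t , tC' , t≁u with neighbour-of-y (adjacent yC' tC' (~-≁⇒≢ y~u t≁u))
        ...       | 1st = ⊥-elim (antipodal 2F false xC tC')
        ...       | 2nd = ⊥-elim (antipodal 2F false zC tC')
        ...       | 3rd = ⊥-elim (u∉C' tC')
        ...       | 4th = ⊥-elim (t≁u (adjacent vA' uA' (≢-sym (~-≁⇒≢ u~x w≁x))))

      A'-nonneighbour∈C' : ∀ {x y u r x'} → x ∈ A → x ∈ B → x ∈ C → y ∈ A → y ∈ B → y ∈ C'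
        → u ∈ A' → u ∈ B → u ∈ C' → r ∈ A' → r ∈ C → x' ∈ A' → x' ≁ x → x' ∈ C'
      A'-nonneighbour∈C' {x} {y} {u} {r} {x'} xA xB xC yA yB yC' uA' uB uC' rA' rC x'A' x'≁x
        with nonneighbour-in-antipode xC
      ... | w , wC' , w≁x = x'-is-the-nonneighbour wC' w≁x (neighbour-of-u (adjacent uC' wC' (~-≁⇒≢ u~x w≁x)))
        where
        u~x : u ~ x
        u~x = adjacent uB xB (apart uA' xA)
        r~x : r ~ x
        r~x = adjacent rC xC (apart rA' xA)
        neighbour-of-u : ∀ {v} → u ~ v → v ∈ₗ x ∷ y ∷ r ∷ x' ∷ []
        neighbour-of-u = among-four-neighbours Δ u~x (adjacent uB yB (apart uA' yA)) (adjacent uA' rA' (apart uC' rC))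
          (adjacent uA' x'A' (~-≁⇒≢ u~x x'≁x))
          (apart xC yC') (apart xA rA') (apart xA x'A') (apart yA rA') (apart yA x'A') (~-≁⇒≢ r~x x'≁x)
        x'-is-the-nonneighbour : ∀ {t} → t ∈ C' → t ≁ x → t ∈ₗ x ∷ y ∷ r ∷ x' ∷ [] → x' ∈ C'
        x'-is-the-nonneighbour tC' _ 1st = ⊥-elim (antipodal 2F false xC tC')
        x'-is-the-nonneighbour _ t≁x 2nd = ⊥-elim (t≁x (adjacent yA xA (apart yC' xC)))
        x'-is-the-nonneighbour _ t≁x 3rd = ⊥-elim (t≁x r~x)
        x'-is-the-nonneighbour tC' _ 4th = tC'

      A∩C'≁A'∩C : ∀ {x y z u r} → x ∈ A → x ∈ B → x ∈ C → y ∈ A → y ∈ C' → z ∈ A → z ∈ B' → z ∈ C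
        → u ∈ A' → u ∈ B → u ∈ C' → r ∈ A' → r ∈ C → y ≁ r
      A∩C'≁A'∩C {x} {y} {z} {u} {r} xA xB xC yA yC' zA zB' zC uA' uB uC' rA' rC
        with nonneighbour-in-antipode rA'
      ... | w , wA , w≁r with equal-or-adjacent xA wA
      ... | inj₁ refl = ⊥-elim (w≁r (adjacent xC rC (apart xA rA')))
      ... | inj₂ x~w
        with among-four-neighbours Δ (adjacent xA yA (apart xC yC')) (adjacent xA zA (apart xB zB'))
               (adjacent xB uB (apart xA uA')) (adjacent xC rC (apart xA rA'))
               (apart yC' zC) (apart yA uA') (apart yA rA') (apart zA uA') (apart zA rA') (apart uC' rC) x~w
      ... | 1st = w≁r
      ... | 2nd = ⊥-elim (w≁r (adjacent zC rC (apart zA rA')))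
      ... | 3rd = ⊥-elim (antipodal 0F false wA uA')
      ... | 4th = ⊥-elim (antipodal 0F false wA rA')

    module FiveCorners (K : CliqueOctahedron) where
      open CliqueOctahedron K
      open Forced

      -- Together with a vertex x' of A' not adjacent to x, which is forced to be of
      -- type A'B'C', these five form an induced octahedron with antipodal pairs
      -- (x, x'), (y, w), (z, u).
      five-corners⇒≅O₃ : ∀ {x y z u w} → x ∈ A → x ∈ B → x ∈ C → y ∈ A → y ∈ B → y ∈ C'
        → z ∈ A → z ∈ B' → z ∈ C → u ∈ A' → u ∈ B → u ∈ C' → w ∈ A' → w ∈ B' → w ∈ C → G ≅ O₃
      five-corners⇒≅O₃ {x} {y} {z} {u} {w} xA xB xC yA yB yC' zA zB' zC uA' uB uC' wA' wB' wC
        with nonneighbour-in-antipode xA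
      ... | x' , x'A' , x'≁x = octahedron⇒≅O₃ Δ conn record
        { pole = λ { 0F s → if s then x' else x ; 1F s → if s then w else y ; 2F s → if s then u else z }
        ; edges₀₁ = λ where
            false false → adjacent xA yA (apart xC yC')
            false true  → adjacent xC wC (apart xA wA')
            true  false → adjacent x'C' yC' (apart x'A' yA)
            true  true  → adjacent x'A' wA' (apart x'C' wC)
        ; edges₀₂ = λ where
            false false → adjacent xA zA (apart xB zB')
            false true  → adjacent xB uB (apart xA uA')
            true  false → adjacent x'B' zB' (apart x'A' zA)
            true  true  → adjacent x'A' uA' (apart x'B' uB)
        ; edges₁₂ = λ where
            false false → adjacent yA zA (apart yB zB')
            false true  → adjacent yB uB (apart yA uA')
            true  false → adjacent wC zC (apart wA' zA)
            true  true  → adjacent wA' uA' (apart wC uC')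
        ; antipodes-nonadjacent = λ where
            0F → x'≁x ∘ ~-sym
            1F → A∩C'≁A'∩C K xA xB xC yA yC' zA zB' zC uA' uB uC' wA' wC
            2F → A∩C'≁A'∩C (swap 1F 2F K) xA xC xB zA zB' yA yC' yB wA' wC wB' uA' uB
        ; antipodes-distinct = λ where
            0F → apart xA x'A'
            1F → apart yA wA'
            2F → apart zA uA'
        }
        where
        x'C' : x' ∈ C'
        x'C' = A'-nonneighbour∈C' K xA xB xC yA yB yC' uA' uB uC' wA' wC x'A' x'≁x
        x'B' : x' ∈ B'
        x'B' = A'-nonneighbour∈C' (swap 1F 2F K) xA xC xB zA zC zB' wA' wC wB' uA' uB x'A' x'≁x

    module TwoCorners (K : CliqueOctahedron) where
      open CliqueOctahedron K
      open Forced
      open FiveCorners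

      ¬AB'C'-A'BC'-A'B'C : ∀ {x α β γ} → x ∈ A → x ∈ B → x ∈ C → α ∈ A → α ∈ B' → α ∈ C'
        → β ∈ A' → β ∈ B → β ∈ C' → γ ∈ A' → γ ∈ B' → γ ∈ C → ⊥
      ¬AB'C'-A'BC'-A'B'C {x} {α} {β} {γ} xA xB xC αA αB' αC' βA' βB βC' γA' γB' γC
        with nonneighbour-in-antipode γB'
      ... | u , uB , u≁γ with equal-or-adjacent xB uB
      ... | inj₁ refl = u≁γ (adjacent xC γC (apart xA γA'))
      ... | inj₂ x~u = contradiction
        where
        neighbour-of-x : ∀ {v} → x ~ v → v ∈ₗ α ∷ β ∷ γ ∷ u ∷ []
        neighbour-of-x = among-four-neighbours Δ (adjacent xA αA (apart xB αB')) (adjacent xB βB (apart xA βA'))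
          (adjacent xC γC (apart xA γA')) x~u
          (apart αB' βB) (apart αA γA') (apart αB' uB) (apart βC' γC)
          (~-≁⇒≢ (adjacent βA' γA' (apart βC' γC)) u≁γ) (apart γB' uB)
        uA : u ∈ A
        uA with nonneighbour-in-antipode βA'
        ... | v , vA , v≁β with equal-or-adjacent xA vA
        ... | inj₁ refl = ⊥-elim (v≁β (adjacent xB βB (apart xA βA')))
        ... | inj₂ x~v with neighbour-of-x x~v
        ... | 1st = ⊥-elim (v≁β (adjacent αC' βC' (apart αB' βB)))
        ... | 2nd = ⊥-elim (antipodal 0F false vA βA')
        ... | 3rd = ⊥-elim (antipodal 0F false vA γA')
        ... | 4th = vA
        contradiction : ⊥
        contradiction with nonneighbour-in-antipode αC'
        ... | w , wC , w≁α with equal-or-adjacent xC wC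
        ... | inj₁ refl = w≁α (adjacent xA αA (apart xB αB'))
        ... | inj₂ x~w with neighbour-of-x x~w
        ... | 1st = antipodal 2F false wC αC'
        ... | 2nd = antipodal 2F false wC βC'
        ... | 3rd = w≁α (adjacent γB' αB' (apart γA' αA))
        ... | 4th = w≁α (adjacent uA αA (apart uB αB'))

      ABC'-AB'C⇒≅O₃ : ∀ {x y z u w} → x ∈ A → x ∈ B → x ∈ C → y ∈ A → y ∈ B → y ∈ C'
        → z ∈ A → z ∈ B' → z ∈ C → u ∈ A' → u ∈ B → w ∈ A' → w ∈ C → G ≅ O₃
      ABC'-AB'C⇒≅O₃ xA xB xC yA yB yC' zA zB' zC uA' uB wA' wC =
        five-corners⇒≅O₃ K xA xB xC yA yB yC' zA zB' zC uA' uB uC' wA' wB' wC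
        where
        uC' = A'∩B⊆C' K xA xB xC yA yB yC' zA zB' zC uA' uB
        wB' = A'∩B⊆C' (swap 1F 2F K) xA xC xB zA zC zB' yA yC' yB wA' wC

      AB'C'-A'BC'⇒≅O₃ : ∀ {x α β u w} → x ∈ A → x ∈ B → x ∈ C → α ∈ A → α ∈ B' → α ∈ C'
        → β ∈ A' → β ∈ B → β ∈ C' → u ∈ A' → u ∈ C → w ∈ B' → w ∈ C → G ≅ O₃
      AB'C'-A'BC'⇒≅O₃ {x} {α} {β} {u} {w} xA xB xC αA αB' αC' βA' βB βC' uA' uC wB' wC with u ≟ w
      ... | yes refl = ⊥-elim (¬AB'C'-A'BC'-A'B'C xA xB xC αA αB' αC' βA' βB βC' uA' wB' wC)
      ... | no u≢w = five-corners⇒≅O₃ (rotate⁻¹ K) xC xA xB wC wA wB' uC uA' uB αC' αA αB' βC' βA' βB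
        where
        neighbour-of-x : ∀ {v} → x ~ v → v ∈ₗ α ∷ β ∷ u ∷ w ∷ []
        neighbour-of-x = among-four-neighbours Δ (adjacent xA αA (apart xB αB')) (adjacent xB βB (apart xA βA'))
          (adjacent xC uC (apart xA uA')) (adjacent xC wC (apart xB wB'))
          (apart αB' βB) (apart αA uA') (apart αC' wC) (apart βC' uC) (apart βB wB') u≢w
        wA : w ∈ A
        wA with w ∈? A
        ... | yes wA = wA
        ... | no w∉A with nonneighbour-in w∉A
        ... | v , vA , v≁w with equal-or-adjacent xA vA
        ... | inj₁ refl = ⊥-elim (v≁w (adjacent xC wC (apart xB wB')))
        ... | inj₂ x~v with neighbour-of-x x~v
        ... | 1st = ⊥-elim (v≁w (adjacent αB' wB' (apart αC' wC)))
        ... | 2nd = ⊥-elim (antipodal 0F false vA βA')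
        ... | 3rd = ⊥-elim (antipodal 0F false vA uA')
        ... | 4th = ⊥-elim (w∉A vA)
        uB : u ∈ B
        uB with u ∈? B
        ... | yes uB = uB
        ... | no u∉B with nonneighbour-in u∉B
        ... | v , vB , v≁u with equal-or-adjacent xB vB
        ... | inj₁ refl = ⊥-elim (v≁u (adjacent xC uC (apart xA uA')))
        ... | inj₂ x~v with neighbour-of-x x~v
        ... | 1st = ⊥-elim (antipodal 1F false vB αB')
        ... | 2nd = ⊥-elim (v≁u (adjacent βA' uA' (apart βC' uC)))
        ... | 3rd = ⊥-elim (u∉B vB)
        ... | 4th = ⊥-elim (antipodal 1F false vB wB')

      AB'C'-A'BC⇒≅O₃ : ∀ {x α γ u w} → x ∈ A → x ∈ B → x ∈ C → α ∈ A → α ∈ B' → α ∈ C'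
        → γ ∈ A' → γ ∈ B → γ ∈ C → u ∈ B → u ∈ C' → w ∈ B' → w ∈ C → G ≅ O₃
      AB'C'-A'BC⇒≅O₃ {x} {α} {γ} {u} {w} xA xB xC αA αB' αC' γA' γB γC uB uC' wB' wC with w ∈? A
      ... | yes wA = five-corners⇒≅O₃ (rotate⁻¹ K) xC xA xB wC wA wB' γC γA' γB αC' αA αB' uC' uA' uB
        where
        uA' = A'∩B⊆C' (swap 0F 2F K) xC xB xA γC γB γA' wC wB' wA uC' uB
      ... | no w∉A = five-corners⇒≅O₃ (swap 0F 1F K) xB xA xC uB uA uC' γB γA' γC αB' αA αC' wB' wA' wC
        where
        neighbour-of-x : ∀ {v} → x ~ v → v ∈ₗ α ∷ γ ∷ u ∷ w ∷ []
        neighbour-of-x = among-four-neighbours Δ (adjacent xA αA (apart xB αB')) (adjacent xB γB (apart xA γA'))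
          (adjacent xB uB (apart xC uC')) (adjacent xC wC (apart xB wB'))
          (apart αA γA') (apart αB' uB) (apart αC' wC) (apart γC uC') (apart γB wB') (apart uB wB')
        uA : u ∈ A
        uA with nonneighbour-in w∉A
        ... | v , vA , v≁w with equal-or-adjacent xA vA
        ... | inj₁ refl = ⊥-elim (v≁w (adjacent xC wC (apart xB wB')))
        ... | inj₂ x~v with neighbour-of-x x~v
        ... | 1st = ⊥-elim (v≁w (adjacent αB' wB' (apart αC' wC)))
        ... | 2nd = ⊥-elim (antipodal 0F false vA γA')
        ... | 3rd = vA
        ... | 4th = ⊥-elim (w∉A vA)
        wA' = A'∩B⊆C' (rotate K) xB xC xA γB γC γA' uB uC' uA wB' wC

    module OneCorner (K : CliqueOctahedron) where
      open CliqueOctahedron K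
      open TwoCorners

      -- The neighbours ab' ac' bc' a'b a'c b'c of x (named after the cliques they
      -- lie in) form a hexagon in this cyclic order, in which only consecutive
      -- vertices can coincide; as x has degree at most 4, two of them do.
      corner⇒≅O₃ : ∀ {x} → x ∈ A → x ∈ B → x ∈ C → G ≅ O₃
      corner⇒≅O₃ {x} xA xB xC
        with common 0F false 1F true | common 0F false 2F true | common 1F false 2F true
           | common 0F true 1F false | common 0F true 2F false | common 1F true 2F false
      ... | ab' , ab'A , ab'B' | ac' , ac'A , ac'C' | bc' , bc'B , bc'C'
          | a'b , a'bA' , a'bB | a'c , a'cA' , a'cC | b'c , b'cB' , b'cC
        with consecutive-equal Δ x~ab' x~ac' x~bc' x~a'b x~a'c
               (apart ab'B' bc'B) (apart ab'B' a'bB) (apart ab'A a'cA') (apart ac'A a'bA') (apart ac'A a'cA')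
               (apart bc'C' a'cC)
           | consecutive-equal Δ x~bc' x~a'b x~a'c x~b'c x~ab'
               (apart bc'C' a'cC) (apart bc'B b'cB') (apart bc'B ab'B') (apart a'bB b'cB') (apart a'bB ab'B')
               (apart a'cA' ab'A)
           | consecutive-equal Δ x~a'c x~b'c x~ab' x~ac' x~bc'
               (apart a'cA' ab'A) (apart a'cA' ac'A) (apart a'cC bc'C') (apart b'cC ac'C') (apart b'cB' bc'B)
               (apart ab'B' bc'B)
        where
        x~ab' = adjacent xA ab'A (apart xB ab'B')
        x~ac' = adjacent xA ac'A (apart xC ac'C')
        x~bc' = adjacent xB bc'B (apart xC bc'C')
        x~a'b = adjacent xB a'bB (apart xA a'bA')
        x~a'c = adjacent xC a'cC (apart xA a'cA')
        x~b'c = adjacent xC b'cC (apart xB b'cB')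
      ... | ≡₁₂ refl | ≡₁₂ refl | _ =
        AB'C'-A'BC'⇒≅O₃ K xA xB xC ab'A ab'B' ac'C' a'bA' a'bB bc'C' a'cA' a'cC b'cB' b'cC
      ... | ≡₁₂ refl | ≡₂₃ refl | _ =
        AB'C'-A'BC⇒≅O₃ K xA xB xC ab'A ab'B' ac'C' a'bA' a'bB a'cC bc'B bc'C' b'cB' b'cC
      ... | ≡₁₂ refl | ≡₃₄ refl | _ =
        AB'C'-A'BC'⇒≅O₃ (swap 1F 2F K) xA xC xB ab'A ac'C' ab'B' a'cA' a'cC b'cB' a'bA' a'bB bc'C' bc'B
      ... | ≡₁₂ refl | ≡₄₅ refl | _ = ⊥-elim (antipodal 2F false b'cC ac'C')
      ... | ≡₂₃ refl | ≡₁₂ refl | _ = ⊥-elim (antipodal 0F false ac'A a'bA')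
      ... | ≡₂₃ refl | ≡₂₃ refl | _ =
        ABC'-AB'C⇒≅O₃ (swap 0F 1F K) xB xA xC bc'B ac'A ac'C' a'bB a'bA' a'cC ab'B' ab'A b'cB' b'cC
      ... | ≡₂₃ refl | ≡₃₄ refl | _ =
        AB'C'-A'BC⇒≅O₃ (rotate⁻¹ K) xC xA xB a'cC a'cA' b'cB' ac'C' ac'A bc'B ab'A ab'B' a'bA' a'bB
      ... | ≡₂₃ refl | ≡₄₅ refl | _ =
        ABC'-AB'C⇒≅O₃ K xA xB xC ac'A bc'B ac'C' ab'A ab'B' b'cC a'bA' a'bB a'cA' a'cC
      ... | ≡₃₄ refl | _ | ≡₁₂ refl =
        AB'C'-A'BC'⇒≅O₃ (rotate K) xB xC xA a'bB bc'C' a'bA' b'cB' a'cC a'cA' ab'B' ab'A ac'C' ac'A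
      ... | ≡₃₄ refl | _ | ≡₂₃ refl =
        AB'C'-A'BC⇒≅O₃ (rotate K) xB xC xA a'bB bc'C' a'bA' ab'B' b'cC ab'A a'cC a'cA' ac'C' ac'A
      ... | ≡₃₄ refl | _ | ≡₃₄ refl =
        AB'C'-A'BC'⇒≅O₃ K xA xB xC ab'A ab'B' ac'C' a'bA' a'bB bc'C' a'cA' a'cC b'cB' b'cC
      ... | ≡₃₄ refl | _ | ≡₄₅ refl = ⊥-elim (antipodal 0F false ac'A a'bA')
      ... | ≡₄₅ refl | _ | ≡₁₂ refl = ⊥-elim (antipodal 1F false a'bB b'cB')
      ... | ≡₄₅ refl | _ | ≡₂₃ refl =
        ABC'-AB'C⇒≅O₃ (swap 0F 2F K) xC xB xA a'cC a'bB a'bA' b'cC ab'B' ab'A bc'C' bc'B ac'C' ac'A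
      ... | ≡₄₅ refl | _ | ≡₃₄ refl =
        AB'C'-A'BC⇒≅O₃ K xA xB xC ab'A ab'B' ac'C' a'bA' a'bB a'cC bc'B bc'C' b'cB' b'cC
      ... | ≡₄₅ refl | _ | ≡₄₅ refl =
        ABC'-AB'C⇒≅O₃ (swap 0F 1F K) xB xA xC bc'B ac'A ac'C' a'bB a'bA' a'cC ab'B' ab'A b'cB' b'cC

    module _ (K : CliqueOctahedron) where
      open CliqueOctahedron K
      open OneCorner

      cliqueOctahedron⇒≅O₃ : G ≅ O₃
      cliqueOctahedron⇒≅O₃
        with common 0F false 1F false | common 0F false 1F true | common 0F false 2F false
           | common 0F false 2F true | common 1F false 2F false | common 1F false 2F true
      ... | y , yA , yB | ab' , ab'A , ab'B' | ac , acA , acC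
          | ac' , ac'A , ac'C' | bc , bcB , bcC | bc' , bc'B , bc'C'
        with y ∈? C | y ∈? C' | ac ∈? B' | ac' ∈? B' | bc ∈? A | bc' ∈? A
      ... | yes yC | _ | _ | _ | _ | _ = corner⇒≅O₃ K yA yB yC
      ... | no _ | yes yC' | _ | _ | _ | _ = corner⇒≅O₃ (flipAxes (false ∷ false ∷ true ∷ []) K) yA yB yC'
      ... | no _ | no _ | yes acB' | _ | _ | _ = corner⇒≅O₃ (flipAxes (false ∷ true ∷ false ∷ []) K) acA acB' acC
      ... | no _ | no _ | no _ | yes ac'B' | _ | _ =
        corner⇒≅O₃ (flipAxes (false ∷ true ∷ true ∷ []) K) ac'A ac'B' ac'C'
      ... | no _ | no _ | no _ | no _ | yes bcA | _ = corner⇒≅O₃ K bcA bcB bcC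
      ... | no _ | no _ | no _ | no _ | no _ | yes bc'A =
        corner⇒≅O₃ (flipAxes (false ∷ false ∷ true ∷ []) K) bc'A bc'B bc'C'
      ... | no y∉C | no y∉C' | no ac∉B' | no ac'∉B' | no bc∉A | no bc'∉A =
        ⊥-elim (no-five-distinct-neighbours Δ
          (adjacent yA ab'A (apart yB ab'B')) (adjacent yA acA (∉∈⇒≢ y∉C acC))
          (adjacent yA ac'A (∉∈⇒≢ y∉C' ac'C')) (adjacent yB bcB (∉∈⇒≢ y∉C bcC))
          (adjacent yB bc'B (∉∈⇒≢ y∉C' bc'C'))
          (≢-sym (∉∈⇒≢ ac∉B' ab'B')) (≢-sym (∉∈⇒≢ ac'∉B' ab'B'))
          (≢-sym (∉∈⇒≢ bc∉A ab'A)) (≢-sym (∉∈⇒≢ bc'∉A ab'A))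
          (apart acC ac'C') (≢-sym (∉∈⇒≢ bc∉A acA)) (≢-sym (∉∈⇒≢ bc'∉A acA))
          (≢-sym (∉∈⇒≢ bc∉A ac'A)) (≢-sym (∉∈⇒≢ bc'∉A ac'A)) (apart bcC bc'C'))

  inducedO₃⇒cliqueOctahedron : KHasInducedO3 G → CliqueOctahedron
  inducedO₃⇒cliqueOctahedron (f , cliques , f-injective , K-adjacency) = record
    { Q = λ a s → f (index a s)
    ; isClique = λ a s → cliques (index a s)
    ; antipodes-disjoint = λ a v∈Q v∈Q' →
        Equivalence.to (O3Adj-index⇔ a false a true)
          (Equivalence.from (K-adjacency _ _)
            (index-antipodes-distinct a ∘ f-injective _ _ , _ , x∈p∩q⁺ (v∈Q , v∈Q')))
          refl
    ; meet = λ {a} {b} a≢b s t →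
        meeting (Equivalence.to (K-adjacency _ _) (Equivalence.from (O3Adj-index⇔ a s b t) a≢b))
    }
    where
    meeting : ∀ {i j} → KAdj G (f i) (f j) → ∃ λ v → v ∈ f i × v ∈ f j
    meeting (_ , v , v∈∩) = v , x∈p∩q⁻ _ _ v∈∩

mainTheorem13 : (G : Graph) → Connected G → MaxDeg≤ G 4 → ¬ (G ≅ O₃)
    → ¬ KHasInducedO3 G
mainTheorem13 G conn Δ G≇O₃ = G≇O₃ ∘ cliqueOctahedron⇒≅O₃ G conn Δ ∘ inducedO₃⇒cliqueOctahedron G
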